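{- For each integer $\ell\geq 4$, if $G$ is the gear graph $G_{2\ell+1}$ or the accordion graph $A_{2\ell}$, then $\operatorname{th}_d(G)=\operatorname{th}_c(G)-2$. Consequently, there exist infinitely many connected graphs $G$ with $\operatorname{th}_d(G) < \operatorname{th}_c(G) - 1$.
   Context: The gear graph $G_{2\ell+1}$ is obtained from the wheel $W_{2\ell+1}$ (a cycle $C_{2\ell}$ plus a hub vertex adjacent to all cycle vertices) by deleting every other edge incident to the hub, so the hub is adjacent to alternate vertices of the cycle. The accordion graph $A_{2\ell}$ is obtained from the fan $F_{2\ell}$ (a path $P_{2\ell-1}$ plus a vertex adjacent to all path vertices) by deleting every other edge incident to that dominating vertex, so it remains adjacent to alternate vertices along the path. Cops and Robbers on a finite simple graph with $n$ vertices: in round $0$ each of $k$ cops and then the robber choose a vertex; in each later round each cop stays or moves along an edge, then the robber does the same; capture occurs when a cop occupies the robber's vertex. $\operatorname{capt}_k(G)$ is the minimum number of rounds for $k$ cops to capture a robber who evades as long as possible ($\infty$ if $k$ is less than the cop number). A vertex is damaged if the robber occupies it in a round in which capture does not occur; $\operatorname{dmg}_k(G)$ is the minimum number of damaged vertices over games with $k$ cops when the robber maximizes damage. $\operatorname{th}_c(G)=\min_{1\le k\le n}\{k+\operatorname{capt}_k(G)\}$, $\operatorname{th}_d(G)=\min_{1\le k\le n}\{k+\operatorname{dmg}_k(G)\}$. -}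

module Defs where

open import Level using (0ℓ)
open import Data.Nat using (ℕ; zero; suc; _+_; _*_; _∸_; _≤_; _<_)
open import Data.Fin using (Fin; toℕ)
open import Data.Fin.Subset using (Subset; ⁅_⁆; _∪_; ∣_∣; ⊥)
open import Data.Product using (Σ; ∃; ∃-syntax; _×_; _,_)
open import Data.Sum using (_⊎_)
open import Relation.Nullary using (¬_)
open import Relation.Binary.PropositionalEquality using (_≡_)

Adj : ℕ → Set₁
Adj n = Fin n → Fin n → Set

record IsSimpleGraph {n : ℕ} (_~_ : Adj n) : Set where
  field
    sym    : ∀ {u v} → u ~ v → v ~ u
    irrefl : ∀ {u} → ¬ (u ~ u)

data Reach {n : ℕ} (_~_ : Adj n) : Fin n → Fin n → Set where
  here : ∀ {u} → Reach _~_ u u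
  step : ∀ {u v w} → u ~ v → Reach _~_ v w → Reach _~_ u w

Connected : {n : ℕ} → Adj n → Set
Connected {n} _~_ = (u v : Fin n) → Reach _~_ u v

-- Cops and Robbers.  A configuration of k cops is a map Fin k → Fin n
-- (several cops may share a vertex).

Cops : ℕ → ℕ → Set
Cops n k = Fin k → Fin n

_∈C_ : {n k : ℕ} → Fin n → Cops n k → Set
r ∈C C = ∃[ i ] C i ≡ r

CopMove : {n k : ℕ} → Adj n → Cops n k → Cops n k → Set
CopMove _~_ C C′ = ∀ i → C′ i ≡ C i ⊎ C i ~ C′ i

RobMove : {n : ℕ} → Adj n → Fin n → Fin n → Set
RobMove _~_ r r′ = r′ ≡ r ⊎ r ~ r′

-- CapWithin _~_ t C r : the cops are at C, the robber (not captured) is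
-- at r, and the next round is to be played.  The cops can force capture
-- within t further rounds.  (Capture happens when a cop moves onto the
-- robber, or when the robber moves onto a cop.)
data CapWithin {n k : ℕ} (_~_ : Adj n) : ℕ → Cops n k → Fin n → Set where
  round : ∀ {t C r} (C′ : Cops n k) → CopMove _~_ C C′ →
          (r ∈C C′ ⊎ (∀ r′ → RobMove _~_ r r′ → r′ ∈C C′ ⊎ CapWithin _~_ t C′ r′)) →
          CapWithin _~_ (suc t) C r

-- k cops can guarantee capture by round t (round 0 = placement)
CanCaptureBy : {n : ℕ} → Adj n → ℕ → ℕ → Set
CanCaptureBy {n} _~_ k t =
  ∃[ C₀ ] ((r₀ : Fin n) → r₀ ∈C C₀ ⊎ CapWithin {k = k} _~_ t C₀ r₀)

-- capt_k(G) = t  (if no such t exists, capt_k(G) = ∞)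
IsCapt : {n : ℕ} → Adj n → ℕ → ℕ → Set
IsCapt _~_ k t = CanCaptureBy _~_ k t × (∀ t′ → CanCaptureBy _~_ k t′ → t ≤ t′)

-- Convention (Cox–Sanaei): the vertex r occupied by the robber
-- at the start of a round becomes damaged iff capture does not occur in
-- that round (neither a cop moves onto r nor the robber moves onto a cop).
-- A state (C, r, D) is: cops at C, uncaught robber at r, D = vertices
-- damaged so far (r itself not yet judged), next round to be played.
-- The cops can keep the damage ≤ d iff they have a strategy such that in
-- every play the damaged set has size ≤ d at all times; this (possibly
-- infinite-play) safety condition is expressed by an invariant set W of
-- states containing every initial state allowed by the cops' placement C₀
-- and which the cops can always maintain (i.e. the set of states
-- reachable under a cop strategy).
record DamageInvariant {n k : ℕ} (_~_ : Adj n) (d : ℕ)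
                       (C₀ : Cops n k) : Set₁ where
  field
    W       : Cops n k → Fin n → Subset n → Set
    bound   : ∀ {C r D} → W C r D → ∣ D ∣ ≤ d
    start   : (r₀ : Fin n) → r₀ ∈C C₀ ⊎ W C₀ r₀ ⊥
    respond : ∀ {C r D} → W C r D →
              ∃[ C′ ] (CopMove _~_ C C′ ×
                (r ∈C C′ ⊎ (∀ r′ → RobMove _~_ r r′ →
                             r′ ∈C C′ ⊎ W C′ r′ (D ∪ ⁅ r ⁆))))

CanLimitDamage : {n : ℕ} → Adj n → ℕ → ℕ → Set₁
CanLimitDamage {n} _~_ k d = Σ (Cops n k) λ C₀ → DamageInvariant _~_ d C₀

IsDmg : {n : ℕ} → Adj n → ℕ → ℕ → Set₁
IsDmg _~_ k d = CanLimitDamage _~_ k d × (∀ d′ → CanLimitDamage _~_ k d′ → d ≤ d′)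

IsThc : {n : ℕ} → Adj n → ℕ → Set
IsThc {n} _~_ t =
  (∃[ k ] ∃[ c ] (1 ≤ k × k ≤ n × IsCapt _~_ k c × t ≡ k + c)) ×
  (∀ k c → 1 ≤ k → k ≤ n → IsCapt _~_ k c → t ≤ k + c)

IsThd : {n : ℕ} → Adj n → ℕ → Set₁
IsThd {n} _~_ t =
  (∃[ k ] ∃[ d ] (1 ≤ k × k ≤ n × IsDmg _~_ k d × t ≡ k + d)) ×
  (∀ k d → 1 ≤ k → k ≤ n → IsDmg _~_ k d → t ≤ k + d)

-- Gear graph G_{2ℓ+1}: vertices 0 … 2ℓ, cycle 0 – 1 – … – (2ℓ-1) – 0,
-- hub 2ℓ adjacent to the even cycle vertices 0, 2, …, 2ℓ-2.

data GearAdj (ℓ : ℕ) : ℕ → ℕ → Set where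
  cyc     : ∀ i → suc i < 2 * ℓ → GearAdj ℓ i (suc i)
  cyc′    : ∀ i → suc i < 2 * ℓ → GearAdj ℓ (suc i) i
  wrap    : ∀ i → suc i ≡ 2 * ℓ → GearAdj ℓ i 0
  wrap′   : ∀ i → suc i ≡ 2 * ℓ → GearAdj ℓ 0 i
  hub     : ∀ j → j < ℓ → GearAdj ℓ (2 * ℓ) (2 * j)
  hub′    : ∀ j → j < ℓ → GearAdj ℓ (2 * j) (2 * ℓ)

gear : (ℓ : ℕ) → Adj (2 * ℓ + 1)
gear ℓ u v = GearAdj ℓ (toℕ u) (toℕ v)

-- Accordion graph A_{2ℓ}: vertices 0 … 2ℓ-1, path 0 – 1 – … – (2ℓ-2),
-- the vertex 2ℓ-1 adjacent to the alternate path vertices 0, 2, …, 2ℓ-2.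

data AccAdj (ℓ : ℕ) : ℕ → ℕ → Set where
  path    : ∀ i → suc (suc i) < 2 * ℓ → AccAdj ℓ i (suc i)
  path′   : ∀ i → suc (suc i) < 2 * ℓ → AccAdj ℓ (suc i) i
  hub     : ∀ j → j < ℓ → AccAdj ℓ (2 * ℓ ∸ 1) (2 * j)
  hub′    : ∀ j → j < ℓ → AccAdj ℓ (2 * j) (2 * ℓ ∸ 1)

accordion : (ℓ : ℕ) → Adj (2 * ℓ)
accordion ℓ u v = AccAdj ℓ (toℕ u) (toℕ v)

-- Both graphs have a centre whose neighbours, the spokes, are pairwise non-adjacent, while every other
-- (rim) vertex has exactly two neighbours, both spokes; and no two vertices dominate the graph.
-- A lone cop never catches the robber, who can always step out of the cop's closed neighbourhood.
-- Two cops starting on the centre catch him within two rounds (a rim robber is trapped by cops on his two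
-- spokes), no two cops can be faster since no pair dominates, and three cops need at least one round;
-- so th_c = 2 + 2 = 4. One cop waiting on the centre keeps the damage to a single vertex, and one vertex
-- is always damaged, so th_d = 1 + 1 = 2. That no pair dominates is a finite check on the vertices
-- 0, …, 6, near which the two graphs look alike once ℓ ≥ 4.
module Submission where

open import Defs
open import Data.Nat
  using (ℕ; zero; suc; _+_; _*_; _∸_; _≤_; _<_; _⊓_; z≤n; s≤s; s≤s⁻¹; _≟_; _≤?_; _<?_)
open import Data.Nat.Properties
open import Data.Nat.Divisibility using (_∣_; _∣?_; divides)
open import Data.Fin using (Fin; zero; suc; toℕ; fromℕ<)
import Data.Fin as Fin
open import Data.Fin.Properties using (toℕ-fromℕ<; toℕ-injective; toℕ<n; all?; any?)
open import Data.Fin.Subset using (Subset; ⁅_⁆; _∪_; ∣_∣; ⊥)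
open import Data.Fin.Subset.Properties using (∣⊥∣≡0; ∣⁅x⁆∣≡1; ∪-identityˡ; ∪-idem)
open import Data.Product using (Σ; ∃-syntax; _×_; _,_; proj₁; proj₂)
open import Data.Sum using (_⊎_; inj₁; inj₂)
open import Function using (_∘_)
open import Relation.Nullary using (¬_; Dec; yes; no; contradiction; ¬?)
open import Relation.Nullary.Decidable using (map′; toWitness; _⊎-dec_; _×-dec_)
open import Relation.Binary.PropositionalEquality using (_≡_; _≢_; refl; sym; trans; cong; subst)

module CopsAndRobbers {n : ℕ} (_~_ : Adj n) where

  Undominated : ∀ {k} → Cops n k → Fin n → Set
  Undominated C r = ∀ i → C i ≢ r × ¬ (C i ~ r)

  NoDominatingPair : Set
  NoDominatingPair = (C : Cops n 2) → ∃[ r ] Undominated C r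

  undominated-∉ : ∀ {k} {C : Cops n k} {r} → Undominated C r → ¬ (r ∈C C)
  undominated-∉ u (i , Ci≡r) = proj₁ (u i) Ci≡r

  undominated-∉-after-move : ∀ {k} {C C′ : Cops n k} {r} →
                             CopMove _~_ C C′ → Undominated C r → ¬ (r ∈C C′)
  undominated-∉-after-move move u (i , C′i≡r) with move i
  ... | inj₁ stay = proj₁ (u i) (trans (sym stay) C′i≡r)
  ... | inj₂ edge = proj₂ (u i) (subst (_ ~_) C′i≡r edge)

  uncaught-at-placement : ∀ {k} {C : Cops n k} {r} → ¬ (r ∈C C) → ¬ (r ∈C C ⊎ CapWithin _~_ 0 C r)
  uncaught-at-placement r∉C (inj₁ r∈C) = r∉C r∈C
  uncaught-at-placement r∉C (inj₂ ())

  lone-cop-undominated : NoDominatingPair → (C : Cops n 1) → ∃[ r ] Undominated C r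
  lone-cop-undominated noPair C with noPair (λ _ → C zero)
  ... | r , u = r , λ { zero → u zero }

  two-cops-need-two-rounds : NoDominatingPair → ∀ t → CanCaptureBy _~_ 2 t → 2 ≤ t
  two-cops-need-two-rounds noPair zero (C , strategy) with noPair C
  ... | r , u = contradiction (strategy r) (uncaught-at-placement (undominated-∉ u))
  two-cops-need-two-rounds noPair (suc zero) (C , strategy) with noPair C
  ... | r , u with strategy r
  ... | inj₁ caught = contradiction caught (undominated-∉ u)
  ... | inj₂ (round C′ move (inj₁ caught)) = contradiction caught (undominated-∉-after-move move u)
  ... | inj₂ (round C′ move (inj₂ respond)) with respond r (inj₁ refl)
  ... | inj₁ caught = contradiction caught (undominated-∉-after-move move u)
  ... | inj₂ ()
  two-cops-need-two-rounds noPair (suc (suc t)) _ = s≤s (s≤s z≤n)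

  -- The robber takes a vertex undominated by the first two cops, or a neighbour of it if the third cop sits there.
  three-cops-need-a-round : (∀ {v} → ¬ (v ~ v)) → (∀ v → ∃[ w ] w ~ v) →
                                     NoDominatingPair → ¬ CanCaptureBy _~_ 3 0
  three-cops-need-a-round irrefl neighbour noPair (C , strategy)
    with noPair (λ { zero → C zero ; (suc zero) → C (suc zero) })
  ... | r , u with C (suc (suc zero)) Fin.≟ r
  ... | no C₂≢r = uncaught-at-placement
          (λ { (zero , C₀≡r) → proj₁ (u zero) C₀≡r
             ; (suc zero , C₁≡r) → proj₁ (u (suc zero)) C₁≡r
             ; (suc (suc zero) , C₂≡r) → C₂≢r C₂≡r })
          (strategy r)
  ... | yes C₂≡r with neighbour r
  ... | w , w~r = uncaught-at-placement
          (λ { (zero , C₀≡w) → proj₂ (u zero) (subst (_~ r) (sym C₀≡w) w~r)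
             ; (suc zero , C₁≡w) → proj₂ (u (suc zero)) (subst (_~ r) (sym C₁≡w) w~r)
             ; (suc (suc zero) , C₂≡w) → irrefl (subst (_~ r) (trans (sym C₂≡w) C₂≡r) w~r) })
          (strategy w)

  one-cop-damages-a-vertex : NoDominatingPair → ∀ d → CanLimitDamage _~_ 1 d → 1 ≤ d
  one-cop-damages-a-vertex noPair d (C , invariant) with lone-cop-undominated noPair C
  ... | r , u with DamageInvariant.start invariant r
  ... | inj₁ caught = contradiction caught (undominated-∉ u)
  ... | inj₂ w with DamageInvariant.respond invariant w
  ... | C′ , move , inj₁ caught = contradiction caught (undominated-∉-after-move move u)
  ... | C′ , move , inj₂ respond with respond r (inj₁ refl)
  ... | inj₁ caught = contradiction caught (undominated-∉-after-move move u)
  ... | inj₂ w′ = subst (_≤ d) damaged≡1 (DamageInvariant.bound invariant w′)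
    where
    damaged≡1 : ∣ ⊥ ∪ ⁅ r ⁆ ∣ ≡ 1
    damaged≡1 = trans (cong ∣_∣ (∪-identityˡ ⁅ r ⁆)) (∣⁅x⁆∣≡1 r)

  capture-throttling≡4 : 2 ≤ n → (∀ t → ¬ CanCaptureBy _~_ 1 t) →
                         CanCaptureBy _~_ 2 2 → (∀ t → CanCaptureBy _~_ 2 t → 2 ≤ t) →
                         ¬ CanCaptureBy _~_ 3 0 → IsThc _~_ 4
  capture-throttling≡4 2≤n one-fails two-in-two two-slow three-slow =
    (2 , 2 , s≤s z≤n , 2≤n , (two-in-two , two-slow) , refl) , lower
    where
    lower : ∀ k c → 1 ≤ k → k ≤ n → IsCapt _~_ k c → 4 ≤ k + c
    lower 1 c _ _ (capture , _) = contradiction capture (one-fails c)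
    lower 2 c _ _ (capture , _) = s≤s (s≤s (two-slow c capture))
    lower 3 zero _ _ (capture , _) = contradiction capture three-slow
    lower 3 (suc c) _ _ _ = s≤s (s≤s (s≤s (s≤s z≤n)))
    lower (suc (suc (suc (suc k)))) c _ _ _ = s≤s (s≤s (s≤s (s≤s z≤n)))

  damage-throttling≡2 : 1 ≤ n → CanLimitDamage _~_ 1 1 →
                        (∀ d → CanLimitDamage _~_ 1 d → 1 ≤ d) → IsThd _~_ 2
  damage-throttling≡2 1≤n one-limits one-damages =
    (1 , 1 , s≤s z≤n , 1≤n , (one-limits , one-damages) , refl) , lower
    where
    lower : ∀ k d → 1 ≤ k → k ≤ n → IsDmg _~_ k d → 2 ≤ k + d
    lower 1 d _ _ (limit , _) = s≤s (one-damages d limit)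
    lower (suc (suc k)) d _ _ _ = s≤s (s≤s z≤n)

distinct⇒2≤n : ∀ {n} {x y : Fin n} → x ≢ y → 2 ≤ n
distinct⇒2≤n {suc zero} {zero} {zero} x≢y = contradiction refl x≢y
distinct⇒2≤n {suc (suc n)} _ = s≤s (s≤s z≤n)

ExactlyTwoSpokeNeighbours : (ℕ → ℕ → Set) → ℕ → ℕ → Set
ExactlyTwoSpokeNeighbours R c r =
  ∃[ a ] ∃[ b ] (a ≢ b × R c a × R c b × R r a × R r b × (∀ {x} → R r x → x ≡ a ⊎ x ≡ b))

-- The vertices are the indices below n; the spokes are the neighbours of the centre, the rim is everything else.
record IsHubGraph (n : ℕ) (R : ℕ → ℕ → Set) : Set where
  field
    symmetric           : ∀ {a b} → R a b → R b a
    irreflexive         : ∀ {a} → ¬ R a a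
    bounded             : ∀ {a b} → R a b → b < n
    centre              : ℕ
    spoke?              : ∀ a → Dec (R centre a)
    spokes-independent  : ∀ {a b} → R centre a → R centre b → ¬ R a b
    another-spoke       : ∀ c → ∃[ a ] (R centre a × a ≢ c)
    spoke-rim-neighbour : ∀ {a} → R centre a → ∃[ b ] (R a b × b ≢ centre × ¬ R centre b)
    rim-neighbours      : ∀ {r} → r < n → r ≢ centre → ¬ R centre r → ExactlyTwoSpokeNeighbours R centre r
    no-dominating-pair  : ∀ x y → ∃[ r ] (r < n × r ≢ x × r ≢ y × ¬ R x r × ¬ R y r)

module HubGraph {n : ℕ} {R : ℕ → ℕ → Set} (G : IsHubGraph n R) where

  open IsHubGraph G using (symmetric; irreflexive; bounded; centre; spoke?; spokes-independent)
  private module ℕ-level = IsHubGraph G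

  _~_ : Adj n
  u ~ v = R (toℕ u) (toℕ v)

  open CopsAndRobbers _~_

  vertex-at : ∀ {x a} → R x a → Σ (Fin n) λ v → R x (toℕ v) × toℕ v ≡ a
  vertex-at {x} {a} x~a = fromℕ< (bounded x~a) , subst (R x) (sym v≡a) x~a , v≡a
    where
    v≡a : toℕ (fromℕ< (bounded x~a)) ≡ a
    v≡a = toℕ-fromℕ< (bounded x~a)

  centre<n : centre < n
  centre<n = bounded (symmetric (proj₁ (proj₂ (ℕ-level.another-spoke 0))))

  H : Fin n
  H = fromℕ< centre<n

  toℕ-H : toℕ H ≡ centre
  toℕ-H = toℕ-fromℕ< centre<n

  Spoke : Fin n → Set
  Spoke v = R centre (toℕ v)

  spoke⇒H~ : ∀ {v} → Spoke v → H ~ v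
  spoke⇒H~ {v} = subst (λ c → R c (toℕ v)) (sym toℕ-H)

  H~⇒spoke : ∀ {v} → H ~ v → Spoke v
  H~⇒spoke {v} = subst (λ c → R c (toℕ v)) toℕ-H

  ≢H⇒≢centre : ∀ {v} → v ≢ H → toℕ v ≢ centre
  ≢H⇒≢centre v≢H v≡c = v≢H (toℕ-injective (trans v≡c (sym toℕ-H)))

  data Kind (v : Fin n) : Set where
    centre-vertex : v ≡ H → Kind v
    spoke         : Spoke v → Kind v
    rim           : v ≢ H → ¬ Spoke v → Kind v

  kind : ∀ v → Kind v
  kind v with v Fin.≟ H | spoke? (toℕ v)
  ... | yes v≡H | _          = centre-vertex v≡H
  ... | no _    | yes spoke-v = spoke spoke-v
  ... | no v≢H  | no ¬spoke   = rim v≢H ¬spoke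

  another-spoke : ∀ c → ∃[ a ] (Spoke a × a ≢ c)
  another-spoke c with ℕ-level.another-spoke (toℕ c)
  ... | _ , centre~a , a≢c with vertex-at centre~a
  ... | v , spoke-v , v≡a = v , spoke-v , λ v≡c → a≢c (trans (sym v≡a) (cong toℕ v≡c))

  spoke-rim-neighbour : ∀ {a} → Spoke a → ∃[ b ] (a ~ b × b ≢ H × ¬ Spoke b)
  spoke-rim-neighbour spoke-a with ℕ-level.spoke-rim-neighbour spoke-a
  ... | _ , a~b , b≢c , ¬spoke-b with vertex-at a~b
  ... | v , a~v , v≡b = v , a~v , (λ v≡H → b≢c (trans (sym v≡b) (trans (cong toℕ v≡H) toℕ-H))) ,
                        λ spoke-v → ¬spoke-b (subst (R centre) v≡b spoke-v)

  rim-neighbours : ∀ {r} → r ≢ H → ¬ Spoke r →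
                   ∃[ a ] ∃[ b ] (a ≢ b × Spoke a × Spoke b × r ~ a × r ~ b ×
                                  (∀ {x} → r ~ x → x ≡ a ⊎ x ≡ b))
  rim-neighbours {r} r≢H ¬spoke-r
    with ℕ-level.rim-neighbours (toℕ<n r) (≢H⇒≢centre r≢H) ¬spoke-r
  ... | a , b , a≢b , spoke-a , spoke-b , r~a , r~b , only with vertex-at r~a | vertex-at r~b
  ... | u , r~u , u≡a | v , r~v , v≡b =
    u , v , (λ u≡v → a≢b (trans (sym u≡a) (trans (cong toℕ u≡v) v≡b))) ,
    subst (R centre) (sym u≡a) spoke-a , subst (R centre) (sym v≡b) spoke-b , r~u , r~v ,
    λ r~x → Data.Sum.map (λ x≡a → toℕ-injective (trans x≡a (sym u≡a)))
                          (λ x≡b → toℕ-injective (trans x≡b (sym v≡b))) (only r~x)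

  no-dominating-pair : NoDominatingPair
  no-dominating-pair C with ℕ-level.no-dominating-pair (toℕ (C zero)) (toℕ (C (suc zero)))
  ... | r , r<n , r≢C₀ , r≢C₁ , ¬C₀~r , ¬C₁~r = v , undominated
    where
    v : Fin n
    v = fromℕ< r<n
    v≡r : toℕ v ≡ r
    v≡r = toℕ-fromℕ< r<n
    undominated : Undominated C v
    undominated zero = (λ C₀≡v → r≢C₀ (trans (sym v≡r) (cong toℕ (sym C₀≡v)))) ,
                       λ C₀~v → ¬C₀~r (subst (R _) v≡r C₀~v)
    undominated (suc zero) = (λ C₁≡v → r≢C₁ (trans (sym v≡r) (cong toℕ (sym C₁≡v)))) ,
                             λ C₁~v → ¬C₁~r (subst (R _) v≡r C₁~v)

  rim-neighbour-spoke : ∀ {r x} → r ≢ H → ¬ Spoke r → r ~ x → Spoke x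
  rim-neighbour-spoke r≢H ¬spoke-r r~x with rim-neighbours r≢H ¬spoke-r
  ... | _ , _ , _ , spoke-a , spoke-b , _ , _ , only with only r~x
  ... | inj₁ refl = spoke-a
  ... | inj₂ refl = spoke-b

  simple : IsSimpleGraph _~_
  simple = record { sym = symmetric ; irrefl = irreflexive }

  reach-centre : ∀ v → Reach _~_ v H
  reach-centre v with kind v
  ... | centre-vertex refl = here
  ... | spoke spoke-v = step (symmetric (spoke⇒H~ spoke-v)) here
  ... | rim v≢H ¬spoke-v with rim-neighbours v≢H ¬spoke-v
  ... | _ , _ , _ , spoke-a , _ , v~a , _ = step v~a (step (symmetric (spoke⇒H~ spoke-a)) here)

  reach-from-centre : ∀ v → Reach _~_ H v
  reach-from-centre v with kind v
  ... | centre-vertex refl = here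
  ... | spoke spoke-v = step (spoke⇒H~ spoke-v) here
  ... | rim v≢H ¬spoke-v with rim-neighbours v≢H ¬spoke-v
  ... | _ , _ , _ , spoke-a , _ , v~a , _ = step (spoke⇒H~ spoke-a) (step (symmetric v~a) here)

  reach-trans : ∀ {u v w} → Reach _~_ u v → Reach _~_ v w → Reach _~_ u w
  reach-trans here q = q
  reach-trans (step u~x p) q = step u~x (reach-trans p q)

  connected : Connected _~_
  connected u v = reach-trans (reach-centre u) (reach-from-centre v)

  has-neighbour : ∀ v → ∃[ w ] w ~ v
  has-neighbour v with kind v
  ... | centre-vertex refl = let (a , spoke-a , _) = another-spoke v in a , symmetric (spoke⇒H~ spoke-a)
  ... | spoke spoke-v = H , spoke⇒H~ spoke-v
  ... | rim v≢H ¬spoke-v with rim-neighbours v≢H ¬spoke-v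
  ... | a , _ , _ , _ , _ , v~a , _ = a , symmetric v~a

  escape : ∀ {c r} → c ≢ r → ∃[ r′ ] (RobMove _~_ r r′ × c ≢ r′ × ¬ (c ~ r′))
  escape {c} {r} c≢r with kind r | kind c
  ... | centre-vertex refl | centre-vertex refl = contradiction refl c≢r
  ... | centre-vertex refl | spoke spoke-c with another-spoke c
  ... | a , spoke-a , a≢c = a , inj₂ (spoke⇒H~ spoke-a) , (λ c≡a → a≢c (sym c≡a)) ,
                           spokes-independent spoke-c spoke-a
  escape {c} {r} c≢r | centre-vertex refl | rim _ ¬spoke-c =
    r , inj₁ refl , c≢r , λ c~H → ¬spoke-c (H~⇒spoke (symmetric c~H))
  escape {c} {r} c≢r | spoke spoke-r | centre-vertex refl with spoke-rim-neighbour spoke-r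
  ... | b , r~b , b≢H , ¬spoke-b =
    b , inj₂ r~b , (λ H≡b → b≢H (sym H≡b)) , λ H~b → ¬spoke-b (H~⇒spoke H~b)
  escape {c} {r} c≢r | spoke spoke-r | spoke spoke-c =
    r , inj₁ refl , c≢r , spokes-independent spoke-c spoke-r
  escape {c} {r} c≢r | spoke spoke-r | rim c≢H ¬spoke-c =
    H , inj₂ (symmetric (spoke⇒H~ spoke-r)) , c≢H , λ c~H → ¬spoke-c (H~⇒spoke (symmetric c~H))
  escape {c} {r} c≢r | rim _ ¬spoke-r | centre-vertex refl =
    r , inj₁ refl , c≢r , λ H~r → ¬spoke-r (H~⇒spoke H~r)
  escape {c} {r} c≢r | rim r≢H ¬spoke-r | _ with rim-neighbours r≢H ¬spoke-r
  ... | a , b , a≢b , spoke-a , spoke-b , r~a , r~b , only with c Fin.≟ a | c Fin.≟ b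
  ... | yes refl | _ = b , inj₂ r~b , a≢b , spokes-independent spoke-a spoke-b
  ... | no _ | yes refl = a , inj₂ r~a , (λ b≡a → a≢b (sym b≡a)) , spokes-independent spoke-b spoke-a
  ... | no c≢a | no c≢b = r , inj₁ refl , c≢r , λ c~r → Data.Sum.[ c≢a , c≢b ] (only (symmetric c~r))

  lone-cop-never-captures-from : ∀ t {C : Cops n 1} {r} → Undominated C r → ¬ CapWithin _~_ t C r
  lone-cop-never-captures-from (suc t) u (round C′ move (inj₁ caught)) =
    undominated-∉-after-move move u caught
  lone-cop-never-captures-from (suc t) {r = r} u (round C′ move (inj₂ respond))
    with escape {C′ zero} {r} (λ C′≡r → undominated-∉-after-move move u (zero , C′≡r))
  ... | r′ , robber-move , c≢r′ , ¬c~r′ with respond r′ robber-move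
  ... | inj₁ (zero , c≡r′) = c≢r′ c≡r′
  ... | inj₂ capture = lone-cop-never-captures-from t (λ { zero → c≢r′ , ¬c~r′ }) capture

  lone-cop-never-captures : ∀ t → ¬ CanCaptureBy _~_ 1 t
  lone-cop-never-captures t (C , strategy) with lone-cop-undominated no-dominating-pair C
  ... | r , u with strategy r
  ... | inj₁ caught = undominated-∉ u caught
  ... | inj₂ capture = lone-cop-never-captures-from t u capture

  two-cops-capture-in-two-rounds : CanCaptureBy _~_ 2 2
  two-cops-capture-in-two-rounds = (λ _ → H) , strategy
    where
    pair : Fin n → Fin n → Cops n 2
    pair a b zero = a
    pair a b (suc zero) = b
    strategy : (r : Fin n) → r ∈C (λ _ → H) ⊎ CapWithin _~_ 2 (λ _ → H) r
    strategy r with kind r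
    ... | centre-vertex r≡H = inj₁ (zero , sym r≡H)
    ... | spoke spoke-r = inj₂ (round (λ _ → r) (λ _ → inj₂ (spoke⇒H~ spoke-r)) (inj₁ (zero , refl)))
    ... | rim r≢H ¬spoke-r with rim-neighbours r≢H ¬spoke-r
    ... | a , b , _ , spoke-a , spoke-b , r~a , r~b , only =
      inj₂ (round (pair a b) occupy-neighbours (inj₂ trapped))
      where
      occupy-neighbours : CopMove _~_ (λ _ → H) (pair a b)
      occupy-neighbours zero = inj₂ (spoke⇒H~ spoke-a)
      occupy-neighbours (suc zero) = inj₂ (spoke⇒H~ spoke-b)
      pounce : CopMove _~_ (pair a b) (pair r b)
      pounce zero = inj₂ (symmetric r~a)
      pounce (suc zero) = inj₁ refl
      trapped : ∀ r′ → RobMove _~_ r r′ → r′ ∈C pair a b ⊎ CapWithin _~_ 1 (pair a b) r′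
      trapped r′ (inj₁ refl) = inj₂ (round (pair r b) pounce (inj₁ (zero , refl)))
      trapped r′ (inj₂ r~r′) with only r~r′
      ... | inj₁ r′≡a = inj₁ (zero , sym r′≡a)
      ... | inj₂ r′≡b = inj₁ (suc zero , sym r′≡b)

  -- The cop stays on the centre until the robber stands on a spoke, and then catches him. A rim robber can
  -- only move to a spoke, so the damage is nothing, the robber's own vertex, or the rim vertex he came from.
  CentreGuard : Cops n 1 → Fin n → Subset n → Set
  CentreGuard C r D = (∀ i → C i ≡ H) × (D ≡ ⊥ ⊎ D ≡ ⁅ r ⁆ ⊎ (Spoke r × ∣ D ∣ ≤ 1))

  lone-cop-damage-one : CanLimitDamage _~_ 1 1
  lone-cop-damage-one = (λ _ → H) , record { W = CentreGuard ; bound = bound ; start = start ; respond = respond }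
    where
    ∣⁅r⁆∣≤1 : ∀ r → ∣ ⁅ r ⁆ ∣ ≤ 1
    ∣⁅r⁆∣≤1 r = subst (_≤ 1) (sym (∣⁅x⁆∣≡1 r)) (s≤s z≤n)
    bound : ∀ {C r D} → CentreGuard C r D → ∣ D ∣ ≤ 1
    bound (_ , inj₁ refl) = subst (_≤ 1) (sym (∣⊥∣≡0 n)) z≤n
    bound {r = r} (_ , inj₂ (inj₁ refl)) = ∣⁅r⁆∣≤1 r
    bound (_ , inj₂ (inj₂ (_ , ∣D∣≤1))) = ∣D∣≤1
    start : (r₀ : Fin n) → r₀ ∈C (λ _ → H) ⊎ CentreGuard (λ _ → H) r₀ ⊥
    start r with r Fin.≟ H
    ... | yes r≡H = inj₁ (zero , sym r≡H)
    ... | no _ = inj₂ ((λ _ → refl) , inj₁ refl)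
    respond : ∀ {C r D} → CentreGuard C r D →
              ∃[ C′ ] (CopMove _~_ C C′ × (r ∈C C′ ⊎ (∀ r′ → RobMove _~_ r r′ →
                                          r′ ∈C C′ ⊎ CentreGuard C′ r′ (D ∪ ⁅ r ⁆))))
    respond {C} {r} {D} (C≡H , damaged) with kind r
    ... | centre-vertex r≡H = C , (λ _ → inj₁ refl) , inj₁ (zero , trans (C≡H zero) (sym r≡H))
    ... | spoke spoke-r = (λ _ → r) , (λ i → inj₂ (subst (_~ r) (sym (C≡H i)) (spoke⇒H~ spoke-r))) ,
                          inj₁ (zero , refl)
    ... | rim r≢H ¬spoke-r = C , (λ _ → inj₁ refl) , inj₂ guard
      where
      absorb : D ≡ ⊥ ⊎ D ≡ ⁅ r ⁆ ⊎ (Spoke r × ∣ D ∣ ≤ 1) → D ∪ ⁅ r ⁆ ≡ ⁅ r ⁆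
      absorb (inj₁ refl) = ∪-identityˡ ⁅ r ⁆
      absorb (inj₂ (inj₁ refl)) = ∪-idem ⁅ r ⁆
      absorb (inj₂ (inj₂ (spoke-r , _))) = contradiction spoke-r ¬spoke-r
      D∪r≡r : D ∪ ⁅ r ⁆ ≡ ⁅ r ⁆
      D∪r≡r = absorb damaged
      guard : ∀ r′ → RobMove _~_ r r′ → r′ ∈C C ⊎ CentreGuard C r′ (D ∪ ⁅ r ⁆)
      guard r′ (inj₁ refl) = inj₂ (C≡H , inj₂ (inj₁ D∪r≡r))
      guard r′ (inj₂ r~r′) =
        inj₂ (C≡H , inj₂ (inj₂ (rim-neighbour-spoke r≢H ¬spoke-r r~r′ ,
                                subst (_≤ 1) (sym (cong ∣_∣ D∪r≡r)) (∣⁅r⁆∣≤1 r))))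

  2≤n : 2 ≤ n
  2≤n = distinct⇒2≤n (proj₂ (proj₂ (another-spoke H)))

  capture-throttling : IsThc _~_ 4
  capture-throttling =
    capture-throttling≡4 2≤n lone-cop-never-captures two-cops-capture-in-two-rounds
      (two-cops-need-two-rounds no-dominating-pair)
      (three-cops-need-a-round irreflexive has-neighbour no-dominating-pair)

  damage-throttling : IsThd _~_ 2
  damage-throttling =
    damage-throttling≡2 (≤-trans (n≤1+n 1) 2≤n) lone-cop-damage-one (one-cop-damages-a-vertex no-dominating-pair)

  throttling-gap : IsThd _~_ 2 × IsThc _~_ 4
  throttling-gap = damage-throttling , capture-throttling

even-or-odd : ∀ x → (∃[ j ] x ≡ 2 * j) ⊎ (∃[ j ] x ≡ suc (2 * j))
even-or-odd zero = inj₁ (0 , refl)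
even-or-odd (suc x) with even-or-odd x
... | inj₁ (j , x≡2j) = inj₂ (j , cong suc x≡2j)
... | inj₂ (j , x≡2j+1) = inj₁ (suc j , trans (cong suc x≡2j+1) (sym (*-suc 2 j)))

EvenBelow : ℕ → ℕ → Set
EvenBelow m a = (∃[ j ] a ≡ 2 * j) × a < m

even-below? : ∀ m a → Dec (EvenBelow m a)
even-below? m a with even-or-odd a | a <? m
... | inj₁ even | yes a<m = yes (even , a<m)
... | inj₁ _ | no a≮m = no λ (_ , a<m) → a≮m a<m
... | inj₂ (j , a≡2j+1) | _ = no λ ((i , a≡2i) , _) → even≢odd i j (trans (sym a≡2i) a≡2j+1)

odd<double : ∀ {j ℓ} → j < ℓ → suc (2 * j) < 2 * ℓ
odd<double {j} {ℓ} j<ℓ = subst (_≤ 2 * ℓ) (*-suc 2 j) (*-monoʳ-≤ 2 j<ℓ)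

-- Both graphs induce the path 0 – 1 – … – 6 on the vertices 0, …, 6, and no vertex of index ≥ 7 is adjacent
-- to an odd one of them; so if s ≤ 6 is x or a neighbour of x, then LocallyCovers x s (local-picture below).
LocallyCovers : ℕ → ℕ → Set
LocallyCovers x s = x ≡ s ⊎ suc x ≡ s ⊎ x ≡ suc s ⊎ (7 ≤ x × 2 ∣ s)

locally-covers? : ∀ x s → Dec (LocallyCovers x s)
locally-covers? x s = x ≟ s ⊎-dec suc x ≟ s ⊎-dec x ≟ suc s ⊎-dec (7 ≤? x ×-dec 2 ∣? s)

clamp : ℕ → Fin 8
clamp x = fromℕ< (s≤s (m⊓n≤n x 7))

locally-covers-clamp : ∀ x {s} → s ≤ 6 → LocallyCovers x s → LocallyCovers (toℕ (clamp x)) s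
locally-covers-clamp x {s} s≤6 covers = subst (λ y → LocallyCovers y s) (sym (toℕ-fromℕ< _)) covers-⊓7
  where
  covers-⊓7 : LocallyCovers (x ⊓ 7) s
  covers-⊓7 with x ≤? 7
  ... | yes x≤7 = subst (λ y → LocallyCovers y s) (sym (m≤n⇒m⊓n≡m x≤7)) covers
  ... | no x≰7 = subst (λ y → LocallyCovers y s) (sym (m≥n⇒m⊓n≡n (<⇒≤ (≰⇒> x≰7))))
                       (inj₂ (inj₂ (inj₂ (≤-refl , even covers))))
    where
    even : LocallyCovers x s → 2 ∣ s
    even (inj₁ refl) = contradiction (≤-trans s≤6 (n≤1+n 6)) x≰7
    even (inj₂ (inj₁ refl)) = contradiction (≤-trans (n≤1+n x) (≤-trans s≤6 (n≤1+n 6))) x≰7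
    even (inj₂ (inj₂ (inj₁ refl))) = contradiction (s≤s s≤6) x≰7
    even (inj₂ (inj₂ (inj₂ (_ , 2∣s)))) = 2∣s

-- Decided by evaluation, with 7 standing for every index ≥ 7; opaque, so that using it does not
-- unfold the decision procedure.
opaque
  two-of-0…7-leave-one-of-0…6 : ∀ (x y : Fin 8) →
                                ∃[ s ] (¬ LocallyCovers (toℕ x) (toℕ {7} s) × ¬ LocallyCovers (toℕ y) (toℕ s))
  two-of-0…7-leave-one-of-0…6 = toWitness {a? = all? λ x → all? λ y → any? λ s →
    ¬? (locally-covers? (toℕ x) (toℕ s)) ×-dec ¬? (locally-covers? (toℕ y) (toℕ s))} _

two-vertices-leave-one-of-0…6 : ∀ x y → ∃[ s ] (s ≤ 6 × ¬ LocallyCovers x s × ¬ LocallyCovers y s)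
two-vertices-leave-one-of-0…6 x y with two-of-0…7-leave-one-of-0…6 (clamp x) (clamp y)
... | s , ¬x , ¬y = toℕ s , s≤6 , ¬x ∘ locally-covers-clamp x s≤6 , ¬y ∘ locally-covers-clamp y s≤6
  where
  s≤6 : toℕ s ≤ 6
  s≤6 = s≤s⁻¹ (toℕ<n s)

no-dominating-pair-from-local-picture : ∀ {n} {R : ℕ → ℕ → Set} → 7 ≤ n →
  (∀ {x s} → R x s → s ≤ 6 → LocallyCovers x s) →
  ∀ x y → ∃[ r ] (r < n × r ≢ x × r ≢ y × ¬ R x r × ¬ R y r)
no-dominating-pair-from-local-picture 7≤n adjacent⇒covers x y with two-vertices-leave-one-of-0…6 x y
... | s , s≤6 , ¬x , ¬y = s , ≤-trans (s≤s s≤6) 7≤n ,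
                          (λ s≡x → ¬x (inj₁ (sym s≡x))) , (λ s≡y → ¬y (inj₁ (sym s≡y))) ,
                          (λ x~s → ¬x (adjacent⇒covers x~s s≤6)) , (λ y~s → ¬y (adjacent⇒covers y~s s≤6))

module GearGraph (ℓ : ℕ) (4≤ℓ : 4 ≤ ℓ) where

  infix 4 _~_
  _~_ : ℕ → ℕ → Set
  _~_ = GearAdj ℓ

  8≤2ℓ : 8 ≤ 2 * ℓ
  8≤2ℓ = *-monoʳ-≤ 2 4≤ℓ

  ≤2ℓ⇒<n : ∀ {x} → x ≤ 2 * ℓ → x < 2 * ℓ + 1
  ≤2ℓ⇒<n {x} x≤2ℓ = subst (x <_) (+-comm 1 (2 * ℓ)) (s≤s x≤2ℓ)

  symmetric : ∀ {a b} → a ~ b → b ~ a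
  symmetric (cyc i p) = cyc′ i p
  symmetric (cyc′ i p) = cyc i p
  symmetric (wrap i p) = wrap′ i p
  symmetric (wrap′ i p) = wrap i p
  symmetric (hub j p) = hub′ j p
  symmetric (hub′ j p) = hub j p

  irreflexive : ∀ {a} → ¬ (a ~ a)
  irreflexive = loop refl
    where
    loop : ∀ {a b} → a ≡ b → ¬ (a ~ b)
    loop a≡b (cyc i p) = 1+n≢n (sym a≡b)
    loop a≡b (cyc′ i p) = 1+n≢n a≡b
    loop a≡b (wrap i p) = even≢odd ℓ 0 (trans (sym p) (cong suc a≡b))
    loop a≡b (wrap′ i p) = even≢odd ℓ 0 (trans (sym p) (cong suc (sym a≡b)))
    loop a≡b (hub j p) = <⇒≢ p (sym (*-cancelˡ-≡ ℓ j 2 a≡b))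
    loop a≡b (hub′ j p) = <⇒≢ p (*-cancelˡ-≡ j ℓ 2 a≡b)

  bounded : ∀ {a b} → a ~ b → b < 2 * ℓ + 1
  bounded (cyc i p) = ≤2ℓ⇒<n (<⇒≤ p)
  bounded (cyc′ i p) = ≤2ℓ⇒<n (<⇒≤ (≤-trans (n≤1+n _) p))
  bounded (wrap i p) = ≤2ℓ⇒<n z≤n
  bounded (wrap′ i p) = ≤2ℓ⇒<n (≤-trans (n≤1+n i) (≤-reflexive p))
  bounded (hub j p) = ≤2ℓ⇒<n (<⇒≤ (*-monoʳ-< 2 p))
  bounded (hub′ j p) = ≤2ℓ⇒<n ≤-refl

  spoke⇒even-below : ∀ {a} → 2 * ℓ ~ a → EvenBelow (2 * ℓ) a
  spoke⇒even-below = from refl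
    where
    from : ∀ {c a} → c ≡ 2 * ℓ → c ~ a → EvenBelow (2 * ℓ) a
    from c≡2ℓ (cyc i p) = contradiction (n≤1+n _) (<⇒≱ (subst (λ c → suc c < 2 * ℓ) c≡2ℓ p))
    from c≡2ℓ (cyc′ i p) = contradiction c≡2ℓ (<⇒≢ p)
    from c≡2ℓ (wrap i p) = contradiction (trans p (sym c≡2ℓ)) 1+n≢n
    from c≡2ℓ (wrap′ i p) = contradiction c≡2ℓ (<⇒≢ (≤-trans (s≤s z≤n) 8≤2ℓ))
    from c≡2ℓ (hub j p) = (j , refl) , *-monoʳ-< 2 p
    from c≡2ℓ (hub′ j p) = contradiction (*-cancelˡ-≡ j ℓ 2 c≡2ℓ) (<⇒≢ p)

  even-below⇒spoke : ∀ {a} → EvenBelow (2 * ℓ) a → 2 * ℓ ~ a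
  even-below⇒spoke ((j , refl) , 2j<2ℓ) = hub j (*-cancelˡ-< 2 j ℓ 2j<2ℓ)

  spoke? : ∀ a → Dec (2 * ℓ ~ a)
  spoke? a = map′ even-below⇒spoke spoke⇒even-below (even-below? (2 * ℓ) a)

  spokes-independent : ∀ {a b} → 2 * ℓ ~ a → 2 * ℓ ~ b → ¬ (a ~ b)
  spokes-independent spoke-a spoke-b = independent (spoke⇒even-below spoke-a) (spoke⇒even-below spoke-b)
    where
    independent : ∀ {a b} → EvenBelow (2 * ℓ) a → EvenBelow (2 * ℓ) b → ¬ (a ~ b)
    independent ((j , a≡2j) , _) ((m , b≡2m) , _) (cyc i p) = even≢odd m j (trans (sym b≡2m) (cong suc a≡2j))
    independent ((j , a≡2j) , _) ((m , b≡2m) , _) (cyc′ i p) = even≢odd j m (trans (sym a≡2j) (cong suc b≡2m))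
    independent ((j , a≡2j) , _) _ (wrap i p) = even≢odd ℓ j (trans (sym p) (cong suc a≡2j))
    independent _ ((m , b≡2m) , _) (wrap′ i p) = even≢odd ℓ m (trans (sym p) (cong suc b≡2m))
    independent (_ , 2ℓ<2ℓ) _ (hub j p) = n≮n _ 2ℓ<2ℓ
    independent _ (_ , 2ℓ<2ℓ) (hub′ j p) = n≮n _ 2ℓ<2ℓ

  another-spoke : ∀ c → ∃[ a ] (2 * ℓ ~ a × a ≢ c)
  another-spoke c with c ≟ 0
  ... | yes c≡0 = 2 , hub 1 (≤-trans (s≤s (s≤s z≤n)) 4≤ℓ) , λ 2≡c → contradiction (trans 2≡c c≡0) λ ()
  ... | no c≢0 = 0 , hub 0 (≤-trans (s≤s z≤n) 4≤ℓ) , λ 0≡c → c≢0 (sym 0≡c)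

  spoke-rim-neighbour : ∀ {a} → 2 * ℓ ~ a → ∃[ b ] (a ~ b × b ≢ 2 * ℓ × ¬ (2 * ℓ ~ b))
  spoke-rim-neighbour spoke-a with spoke⇒even-below spoke-a
  ... | (j , refl) , 2j<2ℓ =
    suc (2 * j) , cyc (2 * j) (odd<double j<ℓ) , (λ 2j+1≡2ℓ → even≢odd ℓ j (sym 2j+1≡2ℓ)) ,
    λ spoke-2j+1 → let ((m , 2j+1≡2m) , _) = spoke⇒even-below spoke-2j+1 in even≢odd m j (sym 2j+1≡2m)
    where
    j<ℓ : j < ℓ
    j<ℓ = *-cancelˡ-< 2 j ℓ 2j<2ℓ

  odd-neighbours : ∀ {r m x} → r ≡ suc (2 * m) → r ~ x →
                   x ≡ 2 * m ⊎ (x ≡ suc (suc (2 * m)) × suc (suc (2 * m)) < 2 * ℓ) ⊎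
                   (x ≡ 0 × suc (suc (2 * m)) ≡ 2 * ℓ)
  odd-neighbours r≡2m+1 (cyc i p) = inj₂ (inj₁ (cong suc r≡2m+1 , subst (λ i → suc i < 2 * ℓ) r≡2m+1 p))
  odd-neighbours r≡2m+1 (cyc′ i p) = inj₁ (suc-injective r≡2m+1)
  odd-neighbours r≡2m+1 (wrap i p) = inj₂ (inj₂ (refl , trans (cong suc (sym r≡2m+1)) p))
  odd-neighbours () (wrap′ i p)
  odd-neighbours {m = m} r≡2m+1 (hub j p) = contradiction r≡2m+1 (even≢odd ℓ m)
  odd-neighbours {m = m} r≡2m+1 (hub′ j p) = contradiction r≡2m+1 (even≢odd j m)

  inner-rim-neighbours : ∀ {m} → suc (suc (2 * m)) < 2 * ℓ → ExactlyTwoSpokeNeighbours _~_ (2 * ℓ) (suc (2 * m))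
  inner-rim-neighbours {m} 2m+2<2ℓ =
    2 * m , suc (suc (2 * m)) , m≢1+n+m (2 * m) {1} ,
    even-below⇒spoke ((m , refl) , <-trans (n<1+n _) 2m+1<2ℓ) ,
    even-below⇒spoke ((suc m , sym (*-suc 2 m)) , 2m+2<2ℓ) ,
    cyc′ (2 * m) 2m+1<2ℓ , cyc (suc (2 * m)) 2m+2<2ℓ , only
    where
    2m+1<2ℓ : suc (2 * m) < 2 * ℓ
    2m+1<2ℓ = <-trans (n<1+n _) 2m+2<2ℓ
    only : ∀ {x} → suc (2 * m) ~ x → x ≡ 2 * m ⊎ x ≡ suc (suc (2 * m))
    only r~x with odd-neighbours {m = m} refl r~x
    ... | inj₁ x≡2m = inj₁ x≡2m
    ... | inj₂ (inj₁ (x≡2m+2 , _)) = inj₂ x≡2m+2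
    ... | inj₂ (inj₂ (_ , 2m+2≡2ℓ)) = contradiction 2m+2≡2ℓ (<⇒≢ 2m+2<2ℓ)

  last-rim-neighbours : ∀ {m} → suc (suc (2 * m)) ≡ 2 * ℓ → ExactlyTwoSpokeNeighbours _~_ (2 * ℓ) (suc (2 * m))
  last-rim-neighbours {m} 2m+2≡2ℓ =
    2 * m , 0 , (λ 2m≡0 → <⇒≢ 2<2ℓ (trans (cong (λ x → suc (suc x)) (sym 2m≡0)) 2m+2≡2ℓ)) ,
    even-below⇒spoke ((m , refl) , <-trans (n<1+n _) 2m+1<2ℓ) , hub 0 (≤-trans (s≤s z≤n) 4≤ℓ) ,
    cyc′ (2 * m) 2m+1<2ℓ , wrap (suc (2 * m)) 2m+2≡2ℓ , only
    where
    2m+1<2ℓ : suc (2 * m) < 2 * ℓ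
    2m+1<2ℓ = ≤-reflexive 2m+2≡2ℓ
    2<2ℓ : 2 < 2 * ℓ
    2<2ℓ = ≤-trans (s≤s (s≤s (s≤s z≤n))) 8≤2ℓ
    only : ∀ {x} → suc (2 * m) ~ x → x ≡ 2 * m ⊎ x ≡ 0
    only r~x with odd-neighbours {m = m} refl r~x
    ... | inj₁ x≡2m = inj₁ x≡2m
    ... | inj₂ (inj₁ (_ , 2m+2<2ℓ)) = contradiction 2m+2≡2ℓ (<⇒≢ 2m+2<2ℓ)
    ... | inj₂ (inj₂ (x≡0 , _)) = inj₂ x≡0

  rim-neighbours : ∀ {r} → r < 2 * ℓ + 1 → r ≢ 2 * ℓ → ¬ (2 * ℓ ~ r) →
                   ExactlyTwoSpokeNeighbours _~_ (2 * ℓ) r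
  rim-neighbours {r} r<n r≢2ℓ ¬spoke-r
    with even-or-odd r | ≤∧≢⇒< (m<1+n⇒m≤n (subst (r <_) (+-comm (2 * ℓ) 1) r<n)) r≢2ℓ
  ... | inj₁ even | r<2ℓ = contradiction (even-below⇒spoke (even , r<2ℓ)) ¬spoke-r
  ... | inj₂ (m , refl) | 2m+1<2ℓ with suc (suc (2 * m)) <? 2 * ℓ
  ... | yes 2m+2<2ℓ = inner-rim-neighbours {m} 2m+2<2ℓ
  ... | no 2m+2≮2ℓ = last-rim-neighbours {m} (≤-antisym 2m+1<2ℓ (≮⇒≥ 2m+2≮2ℓ))

  local-picture : ∀ {x s} → x ~ s → s ≤ 6 → LocallyCovers x s
  local-picture (cyc i p) _ = inj₂ (inj₁ refl)
  local-picture (cyc′ i p) _ = inj₂ (inj₂ (inj₁ refl))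
  local-picture (wrap i p) _ = inj₂ (inj₂ (inj₂ (s≤s⁻¹ (subst (8 ≤_) (sym p) 8≤2ℓ) , divides 0 refl)))
  local-picture (wrap′ i p) i≤6 = contradiction (≤-trans 8≤2ℓ (≤-reflexive (sym p))) (<⇒≱ (s≤s (s≤s i≤6)))
  local-picture (hub j p) _ = inj₂ (inj₂ (inj₂ (≤-trans (n≤1+n 7) 8≤2ℓ , divides j (*-comm 2 j))))
  local-picture (hub′ j p) 2ℓ≤6 = contradiction (≤-trans 8≤2ℓ 2ℓ≤6) (<⇒≱ (s≤s (n≤1+n 6)))

  is-hub-graph : IsHubGraph (2 * ℓ + 1) _~_
  is-hub-graph = record
    { symmetric = symmetric
    ; irreflexive = irreflexive
    ; bounded = bounded
    ; centre = 2 * ℓ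
    ; spoke? = spoke?
    ; spokes-independent = spokes-independent
    ; another-spoke = another-spoke
    ; spoke-rim-neighbour = spoke-rim-neighbour
    ; rim-neighbours = rim-neighbours
    ; no-dominating-pair =
        no-dominating-pair-from-local-picture (≤-trans (n≤1+n 7) (≤-trans 8≤2ℓ (m≤m+n _ 1))) local-picture
    }

module AccordionGraph (ℓ : ℕ) (4≤ℓ : 4 ≤ ℓ) where

  infix 4 _~_
  _~_ : ℕ → ℕ → Set
  _~_ = AccAdj ℓ

  c : ℕ
  c = 2 * ℓ ∸ 1

  8≤2ℓ : 8 ≤ 2 * ℓ
  8≤2ℓ = *-monoʳ-≤ 2 4≤ℓ

  1+c≡2ℓ : suc c ≡ 2 * ℓ
  1+c≡2ℓ = m+[n∸m]≡n (≤-trans (s≤s z≤n) 8≤2ℓ)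

  c<2ℓ : c < 2 * ℓ
  c<2ℓ = ≤-reflexive 1+c≡2ℓ

  <2ℓ⇒≤c : ∀ {x} → x < 2 * ℓ → x ≤ c
  <2ℓ⇒≤c {x} x<2ℓ = s≤s⁻¹ (subst (x <_) (sym 1+c≡2ℓ) x<2ℓ)

  7≤c : 7 ≤ c
  7≤c = s≤s⁻¹ (subst (8 ≤_) (sym 1+c≡2ℓ) 8≤2ℓ)

  c≢even : ∀ j → c ≢ 2 * j
  c≢even j c≡2j = even≢odd ℓ j (trans (sym 1+c≡2ℓ) (cong suc c≡2j))

  symmetric : ∀ {a b} → a ~ b → b ~ a
  symmetric (path i p) = path′ i p
  symmetric (path′ i p) = path i p
  symmetric (hub j p) = hub′ j p
  symmetric (hub′ j p) = hub j p

  irreflexive : ∀ {a} → ¬ (a ~ a)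
  irreflexive = loop refl
    where
    loop : ∀ {a b} → a ≡ b → ¬ (a ~ b)
    loop a≡b (path i p) = 1+n≢n (sym a≡b)
    loop a≡b (path′ i p) = 1+n≢n a≡b
    loop a≡b (hub j p) = c≢even j a≡b
    loop a≡b (hub′ j p) = c≢even j (sym a≡b)

  bounded : ∀ {a b} → a ~ b → b < 2 * ℓ
  bounded (path i p) = ≤-trans (n≤1+n _) p
  bounded (path′ i p) = ≤-trans (n≤1+n _) (≤-trans (n≤1+n _) p)
  bounded (hub j p) = *-monoʳ-< 2 p
  bounded (hub′ j p) = c<2ℓ

  spoke⇒even-below : ∀ {a} → c ~ a → EvenBelow (2 * ℓ) a
  spoke⇒even-below = from refl
    where
    from : ∀ {x a} → x ≡ c → x ~ a → EvenBelow (2 * ℓ) a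
    from x≡c (path i p) =
      contradiction (≤-trans (n≤1+n _) (subst (λ x → suc (suc x) ≤ c) x≡c (<2ℓ⇒≤c p))) 1+n≰n
    from x≡c (path′ i p) = contradiction (subst (λ x → suc x ≤ c) x≡c (<2ℓ⇒≤c p)) 1+n≰n
    from x≡c (hub j p) = (j , refl) , *-monoʳ-< 2 p
    from x≡c (hub′ j p) = contradiction (sym x≡c) (c≢even j)

  even-below⇒spoke : ∀ {a} → EvenBelow (2 * ℓ) a → c ~ a
  even-below⇒spoke ((j , refl) , 2j<2ℓ) = hub j (*-cancelˡ-< 2 j ℓ 2j<2ℓ)

  spoke? : ∀ a → Dec (c ~ a)
  spoke? a = map′ even-below⇒spoke spoke⇒even-below (even-below? (2 * ℓ) a)

  odd-not-spoke : ∀ j → ¬ (c ~ suc (2 * j))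
  odd-not-spoke j spoke-2j+1 with spoke⇒even-below spoke-2j+1
  ... | (m , 2j+1≡2m) , _ = even≢odd m j (sym 2j+1≡2m)

  spokes-independent : ∀ {a b} → c ~ a → c ~ b → ¬ (a ~ b)
  spokes-independent spoke-a spoke-b = independent (spoke⇒even-below spoke-a) (spoke⇒even-below spoke-b)
    where
    independent : ∀ {a b} → EvenBelow (2 * ℓ) a → EvenBelow (2 * ℓ) b → ¬ (a ~ b)
    independent ((j , a≡2j) , _) ((m , b≡2m) , _) (path i p) = even≢odd m j (trans (sym b≡2m) (cong suc a≡2j))
    independent ((j , a≡2j) , _) ((m , b≡2m) , _) (path′ i p) = even≢odd j m (trans (sym a≡2j) (cong suc b≡2m))
    independent ((j , c≡2j) , _) _ (hub _ p) = c≢even j c≡2j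
    independent _ ((m , c≡2m) , _) (hub′ _ p) = c≢even m c≡2m

  another-spoke : ∀ x → ∃[ a ] (c ~ a × a ≢ x)
  another-spoke x with x ≟ 0
  ... | yes x≡0 = 2 , hub 1 (≤-trans (s≤s (s≤s z≤n)) 4≤ℓ) , λ 2≡x → contradiction (trans 2≡x x≡0) λ ()
  ... | no x≢0 = 0 , hub 0 (≤-trans (s≤s z≤n) 4≤ℓ) , λ 0≡x → x≢0 (sym 0≡x)

  last-spoke-rim-neighbour : ∀ {j} → suc j ≡ ℓ → ∃[ b ] (2 * j ~ b × b ≢ c × ¬ (c ~ b))
  last-spoke-rim-neighbour {zero} 1≡ℓ = contradiction (subst (4 ≤_) (sym 1≡ℓ) 4≤ℓ) λ { (s≤s ()) }
  last-spoke-rim-neighbour {suc i} 2+i≡ℓ = suc (2 * i) , edge , 2i+1≢c , odd-not-spoke i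
    where
    2ℓ≡2i+4 : 2 * ℓ ≡ suc (suc (suc (suc (2 * i))))
    2ℓ≡2i+4 = trans (cong (2 *_) (sym 2+i≡ℓ)) (trans (*-suc 2 (suc i)) (cong (λ x → suc (suc x)) (*-suc 2 i)))
    edge : 2 * suc i ~ suc (2 * i)
    edge = subst (_~ suc (2 * i)) (sym (*-suc 2 i))
                 (path′ (suc (2 * i)) (subst (suc (suc (suc (2 * i))) <_) (sym 2ℓ≡2i+4) ≤-refl))
    2i+1≢c : suc (2 * i) ≢ c
    2i+1≢c 2i+1≡c = m≢1+n+m (suc (suc (2 * i))) {1} (trans (cong suc 2i+1≡c) (trans 1+c≡2ℓ 2ℓ≡2i+4))

  spoke-rim-neighbour : ∀ {a} → c ~ a → ∃[ b ] (a ~ b × b ≢ c × ¬ (c ~ b))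
  spoke-rim-neighbour spoke-a with spoke⇒even-below spoke-a
  ... | (j , refl) , 2j<2ℓ with suc j <? ℓ
  ... | yes 1+j<ℓ =
    suc (2 * j) , path (2 * j) 2j+2<2ℓ ,
    (λ 2j+1≡c → <⇒≢ 2j+2<2ℓ (trans (cong suc 2j+1≡c) 1+c≡2ℓ)) , odd-not-spoke j
    where
    2j+2<2ℓ : suc (suc (2 * j)) < 2 * ℓ
    2j+2<2ℓ = subst (_< 2 * ℓ) (*-suc 2 j) (*-monoʳ-< 2 1+j<ℓ)
  ... | no 1+j≮ℓ = last-spoke-rim-neighbour (≤-antisym (*-cancelˡ-< 2 j ℓ 2j<2ℓ) (≮⇒≥ 1+j≮ℓ))

  odd-neighbours : ∀ {r m x} → r ≡ suc (2 * m) → r ≢ c → r ~ x → x ≡ 2 * m ⊎ x ≡ suc (suc (2 * m))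
  odd-neighbours r≡2m+1 _ (path i p) = inj₂ (cong suc r≡2m+1)
  odd-neighbours r≡2m+1 _ (path′ i p) = inj₁ (suc-injective r≡2m+1)
  odd-neighbours _ c≢c (hub j p) = contradiction refl c≢c
  odd-neighbours {m = m} 2j≡2m+1 _ (hub′ j p) = contradiction 2j≡2m+1 (even≢odd j m)

  rim-neighbours : ∀ {r} → r < 2 * ℓ → r ≢ c → ¬ (c ~ r) → ExactlyTwoSpokeNeighbours _~_ c r
  rim-neighbours {r} r<2ℓ r≢c ¬spoke-r with even-or-odd r
  ... | inj₁ even = contradiction (even-below⇒spoke (even , r<2ℓ)) ¬spoke-r
  ... | inj₂ (m , refl) =
    2 * m , suc (suc (2 * m)) , m≢1+n+m (2 * m) {1} ,
    even-below⇒spoke ((m , refl) , <-trans (n<1+n _) r<2ℓ) ,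
    even-below⇒spoke ((suc m , sym (*-suc 2 m)) , ≤-<-trans 2m+1<c c<2ℓ) ,
    path′ (2 * m) (≤-<-trans 2m+1<c c<2ℓ) , path (suc (2 * m)) (≤-<-trans 2m+2<c c<2ℓ) ,
    odd-neighbours {m = m} refl r≢c
    where
    2m+1<c : suc (2 * m) < c
    2m+1<c = ≤∧≢⇒< (<2ℓ⇒≤c r<2ℓ) r≢c
    2m+2<c : suc (suc (2 * m)) < c
    2m+2<c = ≤∧≢⇒< 2m+1<c (λ 2m+2≡c → c≢even (suc m) (trans (sym 2m+2≡c) (sym (*-suc 2 m))))

  local-picture : ∀ {x s} → x ~ s → s ≤ 6 → LocallyCovers x s
  local-picture (path i p) _ = inj₂ (inj₁ refl)
  local-picture (path′ i p) _ = inj₂ (inj₂ (inj₁ refl))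
  local-picture (hub j p) _ = inj₂ (inj₂ (inj₂ (7≤c , divides j (*-comm 2 j))))
  local-picture (hub′ j p) c≤6 = contradiction (≤-trans 7≤c c≤6) (<⇒≱ ≤-refl)

  is-hub-graph : IsHubGraph (2 * ℓ) _~_
  is-hub-graph = record
    { symmetric = symmetric
    ; irreflexive = irreflexive
    ; bounded = bounded
    ; centre = c
    ; spoke? = spoke?
    ; spokes-independent = spokes-independent
    ; another-spoke = another-spoke
    ; spoke-rim-neighbour = spoke-rim-neighbour
    ; rim-neighbours = rim-neighbours
    ; no-dominating-pair = no-dominating-pair-from-local-picture (≤-trans (n≤1+n 7) 8≤2ℓ) local-picture
    }

theorem3p5 : ((ℓ : ℕ) → 4 ≤ ℓ →
               (∃[ t ] (IsThd (gear ℓ) t × IsThc (gear ℓ) (t + 2))) ×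
               (∃[ t ] (IsThd (accordion ℓ) t × IsThc (accordion ℓ) (t + 2)))) ×
             ((N : ℕ) → ∃[ n ] (N ≤ n × Σ (Adj n) λ G →
               IsSimpleGraph G × Connected G ×
               ∃[ a ] ∃[ b ] (IsThd G a × IsThc G b × a + 1 < b)))
theorem3p5 = gear-and-accordion , arbitrarily-large
  where
  gear-and-accordion : (ℓ : ℕ) → 4 ≤ ℓ →
    (∃[ t ] (IsThd (gear ℓ) t × IsThc (gear ℓ) (t + 2))) ×
    (∃[ t ] (IsThd (accordion ℓ) t × IsThc (accordion ℓ) (t + 2)))
  gear-and-accordion ℓ 4≤ℓ =
    (2 , HubGraph.throttling-gap (GearGraph.is-hub-graph ℓ 4≤ℓ)) ,
    (2 , HubGraph.throttling-gap (AccordionGraph.is-hub-graph ℓ 4≤ℓ))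
  arbitrarily-large : (N : ℕ) → ∃[ n ] (N ≤ n × Σ (Adj n) λ G →
    IsSimpleGraph G × Connected G × ∃[ a ] ∃[ b ] (IsThd G a × IsThc G b × a + 1 < b))
  arbitrarily-large N =
    2 * ℓ + 1 , ≤-trans (m≤m+n N 4) (≤-trans (m≤m+n ℓ (ℓ + 0)) (m≤m+n (2 * ℓ) 1)) , gear ℓ ,
    HubGraph.simple G , HubGraph.connected G , 2 , 4 ,
    HubGraph.damage-throttling G , HubGraph.capture-throttling G , ≤-refl
    where
    ℓ : ℕ
    ℓ = N + 4
    G : IsHubGraph (2 * ℓ + 1) (GearAdj ℓ)
    G = GearGraph.is-hub-graph ℓ (m≤n+m 4 N)
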